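{- Let $n\ge2$ be an integer, let $f$ be a $\gamma_{tr3}(P_2\square P_n)$-function such that the number of vertices $v$ with $f(v)=\emptyset$ is minimum among all $\gamma_{tr3}(P_2\square P_n)$-functions, and let $a_j=|f((0,j))|+|f((1,j))|$ for $j\in\{0,\dots,n-1\}$. Then $a_j\ge2$ for each $j\in\{0,1,\dots,n-1\}$.
   Context: $P_m$ denotes the directed path with vertex set $\{0,1,\dots,m-1\}$ and arcs $(i,i+1)$ for $0\le i\le m-2$. The Cartesian product $D_1\square D_2$ has vertex set $V(D_1)\times V(D_2)$, with an arc from $(x_1,y_1)$ to $(x_2,y_2)$ iff either $(x_1,x_2)$ is an arc of $D_1$ and $y_1=y_2$, or $x_1=x_2$ and $(y_1,y_2)$ is an arc of $D_2$; so vertices of $P_2\square P_n$ are $(i,j)$ with $i\in\{0,1\}$, $j\in\{0,\dots,n-1\}$. For a digraph $D$ and positive integer $k$, a $k$RDF is a function $f:V(D)\to\mathcal{P}(\{1,\dots,k\})$ such that every $v$ with $f(v)=\emptyset$ satisfies $\bigcup_{u\in N^-(v)}f(u)=\{1,\dots,k\}$ ($N^-(v)$ the in-neighbors of $v$); its weight is $\sum_v|f(v)|$. A T$k$RDF is a $k$RDF $f$ such that the subdigraph induced by $\{v:f(v)\neq\emptyset\}$ has no isolated vertex; $\gamma_{trk}(D)$ is the minimum weight of a T$k$RDF, and a T$k$RDF of that weight is a $\gamma_{trk}(D)$-function. -}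

module Defs where

open import Data.Nat using (ℕ; suc; _+_)
open import Data.Fin using (Fin; toℕ)
open import Data.Fin.Subset using (Subset; ∣_∣; _∈_) renaming (⊥ to ∅)
open import Data.Product using (_×_; _,_; Σ; ∃-syntax)
open import Data.Sum using (_⊎_)
open import Data.Nat.ListAction using (sum)
open import Data.List using (List; map; length; filter; allFin; cartesianProduct)
open import Data.Vec.Properties using (≡-dec)
import Data.Bool as Bool
open import Relation.Binary.PropositionalEquality using (_≡_; _≢_)
open import Relation.Nullary using (Dec)

-- A finite digraph: vertex type, arc relation, and an enumeration
-- listing every vertex exactly once (used for weights and counts).
record Digraph : Set₁ where
  field
    Vertex   : Set
    Arc      : Vertex → Vertex → Set
    vertices : List Vertex
open Digraph public

PathArc : (m : ℕ) → Fin m → Fin m → Set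
PathArc m x y = toℕ y ≡ suc (toℕ x)

BoxArc : {A B : Set} → (A → A → Set) → (B → B → Set) → A × B → A × B → Set
BoxArc R S (x₁ , y₁) (x₂ , y₂) = (R x₁ x₂ × y₁ ≡ y₂) ⊎ (x₁ ≡ x₂ × S y₁ y₂)

P2□P : ℕ → Digraph
P2□P n = record
  { Vertex   = Fin 2 × Fin n
  ; Arc      = BoxArc (PathArc 2) (PathArc n)
  ; vertices = cartesianProduct (allFin 2) (allFin n)
  }

module _ (D : Digraph) (k : ℕ) where
  private
    V = Vertex D

  IsRDF : (V → Subset k) → Set
  IsRDF f = ∀ v → f v ≡ ∅ → ∀ (c : Fin k) → ∃[ u ] (Arc D u v × c ∈ f u)

  IsTRDF : (V → Subset k) → Set
  IsTRDF f = IsRDF f × (∀ v → f v ≢ ∅ → ∃[ u ] (f u ≢ ∅ × (Arc D u v ⊎ Arc D v u)))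

  weight : (V → Subset k) → ℕ
  weight f = sum (map (λ v → ∣ f v ∣) (vertices D))

  IsγtrkFunction : (V → Subset k) → Set
  IsγtrkFunction f = IsTRDF f × (∀ g → IsTRDF g → weight f Data.Nat.≤ weight g)

  isEmpty? : (S : Subset k) → Dec (S ≡ ∅)
  isEmpty? S = ≡-dec Bool._≟_ S ∅

  numEmpty : (V → Subset k) → ℕ
  numEmpty f = length (filter (λ v → isEmpty? (f v)) (vertices D))

-- Labelling every vertex with {1} is a total 3RDF of weight 2n without empty vertices, and no
-- 3RDF is lighter. Give a column whose labels have sizes x (top) and y (bottom) the credit
-- (x ∸ 2) + (y ∸ 1). An empty top vertex needs a full top vertex just before it, an empty bottom
-- vertex needs the top of its column and the previous bottom to cover all three colours; in each
-- case the credit of the previous column plus the weight of the current one pays for 2 plus the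
-- current credit, so the weight telescopes to at least 2n. Hence γ_tr3(P₂□Pₙ) = 2n is attained
-- with no empty vertex, an f with fewest empty vertices has none, and every column weighs ≥ 2.
module Submission where

open import Defs
open import Data.Nat using (ℕ; zero; suc; _≤_; _<_; _+_; _*_; _∸_; z≤n; s≤s)
open import Data.Nat.Properties
  using (+-assoc; +-suc; +-mono-≤; +-monoˡ-≤; +-monoʳ-≤; ≤-trans; m≤m+n; m≤n+m; m∸n≤m; ∸-monoˡ-≤;
         n≤0⇒n≡0; n≢0⇒n>0; suc-injective; +-commutativeSemigroup; module ≤-Reasoning)
open import Algebra.Properties.CommutativeSemigroup +-commutativeSemigroup using (interchange)
open import Data.Nat.ListAction using (sum)
open import Data.Nat.ListAction.Properties using (sum-++)
open import Data.Fin using (Fin; zero; suc; toℕ; inject₁)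
open import Data.Fin.Properties using (toℕ-injective; toℕ-inject₁)
open import Data.Fin.Subset using (Subset; ∣_∣; _∈_; _∪_; ⁅_⁆; inside; outside) renaming (⊥ to ∅; ⊤ to full)
open import Data.Fin.Subset.Properties using (∣p∣≤∣x∷p∣; p⊆q⇒∣p∣≤∣q∣; ∣⊤∣≡n; x∈p∪q⁺)
open import Data.Vec using ([]; _∷_)
open import Data.List as List using (List; map; tabulate; allFin; _++_; length)
open import Data.List.Properties using (map-++; map-tabulate; ++-identityʳ; filter-some; filter-none)
open import Data.List.Membership.Propositional using (lose) renaming (_∈_ to _∈ᴸ_)
open import Data.List.Membership.Propositional.Properties using (∈-cartesianProduct⁺; ∈-allFin)
open import Data.List.Relation.Unary.All using (universal)
open import Data.Product using (_×_; _,_; proj₁; proj₂; ∃-syntax)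
open import Data.Sum using (_⊎_; inj₁; inj₂)
open import Function using (_∘_)
open import Relation.Nullary using (contradiction)
open import Relation.Binary.PropositionalEquality using (_≡_; _≢_; refl; sym; trans; cong; cong₂; subst; module ≡-Reasoning)

∣p∪q∣≤∣p∣+∣q∣ : ∀ {n} (p q : Subset n) → ∣ p ∪ q ∣ ≤ ∣ p ∣ + ∣ q ∣
∣p∪q∣≤∣p∣+∣q∣ [] [] = z≤n
∣p∪q∣≤∣p∣+∣q∣ (inside ∷ p) (y ∷ q) =
  s≤s (≤-trans (∣p∪q∣≤∣p∣+∣q∣ p q) (+-monoʳ-≤ ∣ p ∣ (∣p∣≤∣x∷p∣ y q)))
∣p∪q∣≤∣p∣+∣q∣ (outside ∷ p) (inside ∷ q) =
  subst (suc ∣ p ∪ q ∣ ≤_) (sym (+-suc ∣ p ∣ ∣ q ∣)) (s≤s (∣p∪q∣≤∣p∣+∣q∣ p q))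
∣p∪q∣≤∣p∣+∣q∣ (outside ∷ p) (outside ∷ q) = ∣p∪q∣≤∣p∣+∣q∣ p q

∣p∣≡0⇒p≡∅ : ∀ {n} (p : Subset n) → ∣ p ∣ ≡ 0 → p ≡ ∅
∣p∣≡0⇒p≡∅ [] _ = refl
∣p∣≡0⇒p≡∅ (outside ∷ p) ∣p∣≡0 = cong (outside ∷_) (∣p∣≡0⇒p≡∅ p ∣p∣≡0)

p≢∅⇒0<∣p∣ : ∀ {n} {p : Subset n} → p ≢ ∅ → 0 < ∣ p ∣
p≢∅⇒0<∣p∣ {p = p} p≢∅ = n≢0⇒n>0 (p≢∅ ∘ ∣p∣≡0⇒p≡∅ p)

full⇒n≤∣p∣ : ∀ {n} (p : Subset n) → (∀ x → x ∈ p) → n ≤ ∣ p ∣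
full⇒n≤∣p∣ {n} p all∈p = subst (_≤ ∣ p ∣) (∣⊤∣≡n n) (p⊆q⇒∣p∣≤∣q∣ {p = full} (λ {x} _ → all∈p x))

cover⇒n≤∣p∣+∣q∣ : ∀ {n} (p q : Subset n) → (∀ x → x ∈ p ⊎ x ∈ q) → n ≤ ∣ p ∣ + ∣ q ∣
cover⇒n≤∣p∣+∣q∣ p q covers =
  ≤-trans (full⇒n≤∣p∣ (p ∪ q) (x∈p∪q⁺ ∘ covers)) (∣p∪q∣≤∣p∣+∣q∣ p q)

sum-tabulate-+ : ∀ {n} (g h : Fin n → ℕ) →
  sum (tabulate (λ j → g j + h j)) ≡ sum (tabulate g) + sum (tabulate h)
sum-tabulate-+ {zero} g h = refl
sum-tabulate-+ {suc n} g h =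
  trans (cong (g zero + h zero +_) (sum-tabulate-+ (g ∘ suc) (h ∘ suc))) (interchange (g zero) (h zero) _ _)

sum-tabulate-const : ∀ n m → sum (tabulate {n = n} (λ _ → m)) ≡ n * m
sum-tabulate-const zero m = refl
sum-tabulate-const (suc n) m = cong (m +_) (sum-tabulate-const n m)

Column : Set
Column = ℕ × ℕ

size : Column → ℕ
size (x , y) = x + y

credit : Column → ℕ
credit (x , y) = (x ∸ 2) + (y ∸ 1)

-- Label sizes of columns j-1 and j: (0,j) has the single in-neighbour (0,j-1), and (1,j) has
-- the in-neighbours (0,j) and (1,j-1).
ColumnStep : Column → Column → Set
ColumnStep (x′ , y′) (x , y) = (x ≡ 0 → 3 ≤ x′) × (y ≡ 0 → 3 ≤ x + y′)

credit-step : ∀ p c → ColumnStep p c → 2 + credit c ≤ credit p + size c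
credit-step (x′ , y′) (zero , zero) (_ , bottom) =
  ≤-trans (∸-monoˡ-≤ 1 (bottom refl)) (≤-trans (m≤n+m (y′ ∸ 1) (x′ ∸ 2)) (m≤m+n _ 0))
credit-step (x′ , y′) (zero , suc y) (top , _) =
  +-monoˡ-≤ (suc y) (≤-trans (∸-monoˡ-≤ 2 (top refl)) (m≤m+n (x′ ∸ 2) (y′ ∸ 1)))
credit-step (x′ , y′) (suc zero , zero) (_ , bottom) =
  +-monoˡ-≤ 1 (≤-trans (∸-monoˡ-≤ 2 (bottom refl)) (m≤n+m (y′ ∸ 1) (x′ ∸ 2)))
credit-step p (suc (suc x) , zero) _ = m≤n+m (suc (suc x) + 0) (credit p)
credit-step p (suc x , suc y) _ = begin
  2 + ((x ∸ 1) + y) ≤⟨ +-monoʳ-≤ 2 (+-monoˡ-≤ y (m∸n≤m x 1)) ⟩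
  2 + (x + y)       ≡⟨ cong suc (sym (+-suc x y)) ⟩
  suc x + suc y     ≤⟨ m≤n+m (suc x + suc y) (credit p) ⟩
  credit p + (suc x + suc y) ∎
  where open ≤-Reasoning

previous : ∀ {n} → Column → (Fin n → Column) → Fin n → Column
previous p c zero = p
previous p c (suc j) = c (inject₁ j)

credit-chain : ∀ {n} p (c : Fin n → Column) → (∀ j → ColumnStep (previous p c j) (c j)) →
  n * 2 ≤ credit p + sum (tabulate (size ∘ c))
credit-chain {zero} p c steps = z≤n
credit-chain {suc n} p c steps = begin
  2 + n * 2                         ≤⟨ +-monoʳ-≤ 2 (credit-chain (c zero) (c ∘ suc) shifted) ⟩
  2 + (credit (c zero) + rest)      ≡⟨ sym (+-assoc 2 (credit (c zero)) rest) ⟩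
  2 + credit (c zero) + rest        ≤⟨ +-monoˡ-≤ rest (credit-step p (c zero) (steps zero)) ⟩
  credit p + size (c zero) + rest   ≡⟨ +-assoc (credit p) (size (c zero)) rest ⟩
  credit p + (size (c zero) + rest) ∎
  where
  open ≤-Reasoning
  rest : ℕ
  rest = sum (tabulate (size ∘ c ∘ suc))
  shifted : ∀ j → ColumnStep (previous (c zero) (c ∘ suc) j) (c (suc j))
  shifted zero = steps (suc zero)
  shifted (suc j) = steps (suc (suc j))

columns : ∀ {n} → (Fin 2 × Fin n → Subset 3) → Fin n → Column
columns f j = ∣ f (zero , j) ∣ , ∣ f (suc zero , j) ∣

path-arc-into-suc : ∀ {m} {y : Fin (suc m)} (i : Fin m) → PathArc (suc m) y (suc i) → y ≡ inject₁ i
path-arc-into-suc i arc = toℕ-injective (trans (sym (suc-injective arc)) (sym (toℕ-inject₁ i)))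

module _ {n} {f : Fin 2 × Fin n → Subset 3} (rdf : IsRDF (P2□P n) 3 f) where

  top-step : ∀ j → f (zero , j) ≡ ∅ → 3 ≤ proj₁ (previous (0 , 0) (columns f) j)
  top-step zero empty with rdf (zero , zero) empty zero
  ... | _ , inj₁ (() , _) , _
  ... | _ , inj₂ (_ , ()) , _
  top-step (suc i) empty = full⇒n≤∣p∣ (f (zero , inject₁ i)) dominates
    where
    dominates : ∀ c → c ∈ f (zero , inject₁ i)
    dominates c with rdf (zero , suc i) empty c
    ... | _ , inj₁ (() , _) , _
    ... | (zero , y) , inj₂ (refl , arc) , c∈ = subst (λ y → c ∈ f (zero , y)) (path-arc-into-suc i arc) c∈

  bottom-step : ∀ j → f (suc zero , j) ≡ ∅ →
    3 ≤ ∣ f (zero , j) ∣ + proj₂ (previous (0 , 0) (columns f) j)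
  bottom-step zero empty = cover⇒n≤∣p∣+∣q∣ (f (zero , zero)) ∅ dominates
    where
    dominates : ∀ c → c ∈ f (zero , zero) ⊎ c ∈ ∅
    dominates c with rdf (suc zero , zero) empty c
    ... | (zero , _) , inj₁ (refl , refl) , c∈ = inj₁ c∈
    ... | (suc zero , _) , inj₁ (() , _) , _
    ... | (suc zero , _) , inj₂ (refl , ()) , _
  bottom-step (suc i) empty =
    cover⇒n≤∣p∣+∣q∣ (f (zero , suc i)) (f (suc zero , inject₁ i)) dominates
    where
    dominates : ∀ c → c ∈ f (zero , suc i) ⊎ c ∈ f (suc zero , inject₁ i)
    dominates c with rdf (suc zero , suc i) empty c
    ... | (zero , _) , inj₁ (refl , refl) , c∈ = inj₁ c∈
    ... | (suc zero , _) , inj₁ (() , _) , _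
    ... | (suc zero , y) , inj₂ (refl , arc) , c∈ =
      inj₂ (subst (λ y → c ∈ f (suc zero , y)) (path-arc-into-suc i arc) c∈)

  rdf⇒column-steps : ∀ j → ColumnStep (previous (0 , 0) (columns f) j) (columns f j)
  rdf⇒column-steps j =
    (λ ∣top∣≡0 → top-step j (∣p∣≡0⇒p≡∅ _ ∣top∣≡0)) ,
    (λ ∣bottom∣≡0 → bottom-step j (∣p∣≡0⇒p≡∅ _ ∣bottom∣≡0))

weight≡column-sum : ∀ {n} (f : Fin 2 × Fin n → Subset 3) →
  weight (P2□P n) 3 f ≡ sum (tabulate (size ∘ columns f))
weight≡column-sum {n} f = begin
  weight (P2□P n) 3 f
    ≡⟨ cong sum (map-++ ∣f∣ (row zero) (row (suc zero) ++ List.[])) ⟩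
  sum (map ∣f∣ (row zero) ++ map ∣f∣ (row (suc zero) ++ List.[]))
    ≡⟨ sum-++ (map ∣f∣ (row zero)) (map ∣f∣ (row (suc zero) ++ List.[])) ⟩
  sum (map ∣f∣ (row zero)) + sum (map ∣f∣ (row (suc zero) ++ List.[]))
    ≡⟨ cong (λ r → sum (map ∣f∣ (row zero)) + sum (map ∣f∣ r)) (++-identityʳ (row (suc zero))) ⟩
  sum (map ∣f∣ (row zero)) + sum (map ∣f∣ (row (suc zero)))
    ≡⟨ cong₂ _+_ (row-sum zero) (row-sum (suc zero)) ⟩
  sum (tabulate (λ j → ∣ f (zero , j) ∣)) + sum (tabulate (λ j → ∣ f (suc zero , j) ∣))
    ≡⟨ sym (sum-tabulate-+ (λ j → ∣ f (zero , j) ∣) (λ j → ∣ f (suc zero , j) ∣)) ⟩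
  sum (tabulate (size ∘ columns f)) ∎
  where
  open ≡-Reasoning
  ∣f∣ : Fin 2 × Fin n → ℕ
  ∣f∣ v = ∣ f v ∣
  row : Fin 2 → List (Fin 2 × Fin n)
  row i = map (i ,_) (allFin n)
  row-sum : ∀ i → sum (map ∣f∣ (row i)) ≡ sum (tabulate (λ j → ∣ f (i , j) ∣))
  row-sum i = cong sum (trans (cong (map ∣f∣) (map-tabulate (λ j → j) (i ,_))) (map-tabulate (i ,_) ∣f∣))

rdf-weight-lower-bound : ∀ {n} {f : Fin 2 × Fin n → Subset 3} →
  IsRDF (P2□P n) 3 f → n * 2 ≤ weight (P2□P n) 3 f
rdf-weight-lower-bound {n} {f} rdf =
  subst (n * 2 ≤_) (sym (weight≡column-sum f)) (credit-chain (0 , 0) (columns f) (rdf⇒column-steps rdf))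

module _ (D : Digraph) (k : ℕ) (f : Vertex D → Subset k) where

  nonempty⇒numEmpty≡0 : (∀ v → f v ≢ ∅) → numEmpty D k f ≡ 0
  nonempty⇒numEmpty≡0 nonempty =
    cong length (filter-none (isEmpty? D k ∘ f) (universal nonempty (vertices D)))

  numEmpty≡0⇒nonempty : numEmpty D k f ≡ 0 → ∀ {v} → v ∈ᴸ vertices D → f v ≢ ∅
  numEmpty≡0⇒nonempty none v∈D fv≡∅ =
    contradiction (subst (0 <_) none (filter-some (isEmpty? D k ∘ f) (lose v∈D fv≡∅))) (λ ())

singletons : ∀ {n} → Fin 2 × Fin n → Subset 3
singletons _ = ⁅ zero ⁆

singletons-nonempty : ∀ {n} (v : Fin 2 × Fin n) → singletons v ≢ ∅
singletons-nonempty _ ()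

singletons-total : ∀ n → IsTRDF (P2□P n) 3 singletons
singletons-total n = (λ v empty → contradiction empty (singletons-nonempty v)) , partner
  where
  partner : ∀ v → singletons v ≢ ∅ →
    ∃[ u ] (singletons u ≢ ∅ × (Arc (P2□P n) u v ⊎ Arc (P2□P n) v u))
  partner (zero , j) _ = (suc zero , j) , singletons-nonempty (suc zero , j) , inj₂ (inj₁ (refl , refl))
  partner (suc zero , j) _ = (zero , j) , singletons-nonempty (zero , j) , inj₁ (inj₁ (refl , refl))

singletons-γ : ∀ n → IsγtrkFunction (P2□P n) 3 singletons
singletons-γ n = singletons-total n , λ g (g-rdf , _) →
  subst (_≤ weight (P2□P n) 3 g) (sym weight-singletons) (rdf-weight-lower-bound {n} {g} g-rdf)
  where
  weight-singletons : weight (P2□P n) 3 singletons ≡ n * 2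
  weight-singletons = trans (weight≡column-sum (singletons {n})) (sum-tabulate-const n 2)

lemma4p3 : (n : ℕ) → 2 ≤ n → (f : Fin 2 × Fin n → Subset 3) →
    IsγtrkFunction (P2□P n) 3 f →
    (∀ g → IsγtrkFunction (P2□P n) 3 g → numEmpty (P2□P n) 3 f ≤ numEmpty (P2□P n) 3 g) →
    ∀ (j : Fin n) → 2 ≤ ∣ f (zero , j) ∣ + ∣ f (suc zero , j) ∣
lemma4p3 n _ f _ fewest-empty j = +-mono-≤ (p≢∅⇒0<∣p∣ (nonempty zero)) (p≢∅⇒0<∣p∣ (nonempty (suc zero)))
  where
  no-empty : numEmpty (P2□P n) 3 f ≡ 0
  no-empty = n≤0⇒n≡0 (subst (numEmpty (P2□P n) 3 f ≤_)
    (nonempty⇒numEmpty≡0 (P2□P n) 3 singletons singletons-nonempty)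
    (fewest-empty singletons (singletons-γ n)))
  nonempty : ∀ i → f (i , j) ≢ ∅
  nonempty i = numEmpty≡0⇒nonempty (P2□P n) 3 f no-empty (∈-cartesianProduct⁺ (∈-allFin i) (∈-allFin j))
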